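{- Let $n\ge 1$ and let $G$ be a random threshold graph on $n$ vertices. Then for every integer $k\ge 0$, $$P\big(h(\mathrm{seq}(G))=k\big)=\left(\tfrac12\right)^{n-1}\binom{n-1}{\left\lfloor \frac{n+k}{2}\right\rfloor}.$$
   Context: A threshold graph on $n$ vertices is built from a single base vertex by adding $n-1$ vertices one at a time, each either isolated or dominating (adjacent to all existing vertices); its creation sequence $\mathrm{seq}(G)=s_1\dots s_{n-1}$ has $s_i=1$ if the $i$-th added vertex was dominating and $s_i=0$ if isolated. A random threshold graph on $n$ vertices is obtained by choosing $n$ weights independently and uniformly in $[0,1]$ and joining two vertices iff their weights sum to more than $1$; it is known that this makes $\mathrm{seq}(G)$ uniformly distributed on $\{0,1\}^{n-1}$ (each unlabeled threshold graph has probability $2^{1-n}$). For a binary sequence $s=s_1\dots s_m$ and $0\le k\le m$, the $k$-th tail of $s$ is $s_{m-k+1}\dots s_m$ (the last $k$ digits; empty for $k=0$), and $z_k(s)$, $u_k(s)$ denote the numbers of zeros and ones in it. Define $h(s)=\max_{0\le k\le m}\{z_k(s)-u_k(s)\}$. -}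

module Defs where

open import Data.Bool using (Bool; true; false)
open import Data.Nat using (ℕ; zero; suc; _∸_)
open import Data.Integer using (ℤ; +_; _-_; _⊔_; _≟_)
open import Data.List using (List; []; _∷_; _++_; map; drop; length; filter; [_])

-- Binary sequences are lists of Bool: false = digit 0 (isolated), true = digit 1 (dominating).

zeros : List Bool → ℕ
zeros [] = 0
zeros (false ∷ s) = suc (zeros s)
zeros (true ∷ s) = zeros s

ones : List Bool → ℕ
ones [] = 0
ones (false ∷ s) = ones s
ones (true ∷ s) = suc (ones s)

tailK : ℕ → List Bool → List Bool
tailK k s = drop (length s ∸ k) s

diffK : List Bool → ℕ → ℤ
diffK s k = + zeros (tailK k s) - + ones (tailK k s)

maxUpTo : (ℕ → ℤ) → ℕ → ℤ
maxUpTo f zero = f 0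
maxUpTo f (suc j) = maxUpTo f j ⊔ f (suc j)

h : List Bool → ℤ
h s = maxUpTo (diffK s) (length s)

allSeqs : ℕ → List (List Bool)
allSeqs zero = [ [] ]
allSeqs (suc m) = map (false ∷_) (allSeqs m) ++ map (true ∷_) (allSeqs m)

countH : ℕ → ℤ → ℕ
countH m k = length (filter (λ s → h s ≟ k) (allSeqs m))

-- Reading a sequence from left to right, h satisfies the Lindley recursion
-- h(s x) = max(0, h(s) ± 1): a digit 0 moves up by one, a digit 1 moves down by one,
-- reflected at 0. So h(s) is the endpoint of a simple random walk reflected at 0, and the
-- number N(m, k) of sequences of length m with h = k obeys N(m+1, 0) = N(m, 0) + N(m, 1)
-- and N(m+1, k+1) = N(m, k) + N(m, k+2). By Pascal's rule and the symmetry
-- C(m, ⌊m/2⌋) = C(m, ⌈m/2⌉), the binomial coefficient C(m, ⌈(m+k)/2⌉) satisfies the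
-- same recursion with the same initial values.
module Submission where

open import Defs
open import Data.Nat using (ℕ; _∸_; _+_; _≤_; _/_)
open import Data.Nat.Combinatorics using (_C_)
open import Data.Integer using (+_)
open import Relation.Binary.PropositionalEquality using (_≡_)

open import Data.Bool using (Bool; true; false)
open import Data.Integer as ℤ using (ℤ; 0ℤ; 1ℤ; -1ℤ; _-_; _⊔_)
open import Data.Integer.Tactic.RingSolver using (solve-∀)
import Data.Integer.Properties as ℤ
open import Data.List using (List; []; _∷_; _++_; _∷ʳ_; map; filter; foldl; length)
open import Data.List.Properties using (filter-++; length-++; foldl-∷ʳ)
open import Data.List.Reverse using (Reverse; []; _∶_∶ʳ_; reverseView)
open import Data.Nat as ℕ using (zero; suc; pred; ⌊_/2⌋; ⌈_/2⌉; z≤n; s≤s; _≟_)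
open import Data.Nat.Combinatorics using (nCk+nC[k+1]≡[n+1]C[k+1]; nCk≡nC[n∸k])
open import Data.Nat.DivMod using (m/n≡1+[m∸n]/n)
import Data.Nat.Properties as ℕ
open import Algebra.Properties.CommutativeSemigroup ℕ.+-commutativeSemigroup using (interchange)
open import Relation.Nullary using (does)
open import Relation.Unary using (Decidable)
open import Relation.Binary.PropositionalEquality using (refl; sym; trans; cong; cong₂)
open Relation.Binary.PropositionalEquality.≡-Reasoning

step : Bool → ℤ
step false = 1ℤ
step true  = -1ℤ

excess : List Bool → ℤ
excess s = + zeros s - + ones s

excess-∷ : ∀ x s → excess (x ∷ s) ≡ step x ℤ.+ excess s
excess-∷ false s = ℤ.+-assoc 1ℤ (+ zeros s) (ℤ.- + ones s)
excess-∷ true  s = subtract-suc (+ zeros s) (+ ones s)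
  where
  subtract-suc : ∀ i j → i - (1ℤ ℤ.+ j) ≡ ℤ.- 1ℤ ℤ.+ (i - j)
  subtract-suc = solve-∀

excess-∷ʳ : ∀ s x → excess (s ∷ʳ x) ≡ excess s ℤ.+ step x
excess-∷ʳ []      false = refl
excess-∷ʳ []      true  = refl
excess-∷ʳ (y ∷ s) x = begin
  excess (y ∷ (s ∷ʳ x))          ≡⟨ excess-∷ y (s ∷ʳ x) ⟩
  step y ℤ.+ excess (s ∷ʳ x)     ≡⟨ cong (λ t → step y ℤ.+ t) (excess-∷ʳ s x) ⟩
  step y ℤ.+ (excess s ℤ.+ step x) ≡⟨ sym (ℤ.+-assoc (step y) (excess s) (step x)) ⟩
  step y ℤ.+ excess s ℤ.+ step x ≡⟨ cong (λ t → t ℤ.+ step x) (sym (excess-∷ y s)) ⟩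
  excess (y ∷ s) ℤ.+ step x      ∎

maxUpTo-cong : ∀ {f g : ℕ → ℤ} j → (∀ {i} → i ≤ j → f i ≡ g i) → maxUpTo f j ≡ maxUpTo g j
maxUpTo-cong zero    f≗g = f≗g z≤n
maxUpTo-cong (suc j) f≗g =
  cong₂ _⊔_ (maxUpTo-cong j (λ i≤j → f≗g (ℕ.m≤n⇒m≤1+n i≤j))) (f≗g ℕ.≤-refl)

diffK-∷ : ∀ x s {k} → k ≤ length s → diffK (x ∷ s) k ≡ diffK s k
diffK-∷ x s k≤ rewrite ℕ.+-∸-assoc 1 k≤ = refl

diffK-length : ∀ s → diffK s (length s) ≡ excess s
diffK-length s rewrite ℕ.n∸n≡0 (length s) = refl

h-∷ : ∀ x s → h (x ∷ s) ≡ h s ⊔ excess (x ∷ s)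
h-∷ x s = cong₂ _⊔_ (maxUpTo-cong (length s) (diffK-∷ x s)) (diffK-length (x ∷ s))

h-∷ʳ : ∀ s x → h (s ∷ʳ x) ≡ 0ℤ ⊔ (h s ℤ.+ step x)
h-∷ʳ []      false = refl
h-∷ʳ []      true  = refl
h-∷ʳ (y ∷ s) x = begin
  h (y ∷ (s ∷ʳ x))                                       ≡⟨ h-∷ y (s ∷ʳ x) ⟩
  h (s ∷ʳ x) ⊔ excess (y ∷ (s ∷ʳ x))                     ≡⟨ cong₂ _⊔_ (h-∷ʳ s x) (excess-∷ʳ (y ∷ s) x) ⟩
  (0ℤ ⊔ (h s ℤ.+ step x)) ⊔ (excess (y ∷ s) ℤ.+ step x)  ≡⟨ ℤ.⊔-assoc 0ℤ _ _ ⟩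
  0ℤ ⊔ ((h s ℤ.+ step x) ⊔ (excess (y ∷ s) ℤ.+ step x))  ≡⟨ cong (0ℤ ⊔_) (sym (+step-distrib-⊔ (h s) _)) ⟩
  0ℤ ⊔ ((h s ⊔ excess (y ∷ s)) ℤ.+ step x)               ≡⟨ cong (λ t → 0ℤ ⊔ (t ℤ.+ step x)) (sym (h-∷ y s)) ⟩
  0ℤ ⊔ (h (y ∷ s) ℤ.+ step x)                            ∎
  where
  +step-distrib-⊔ : ∀ i j → (i ⊔ j) ℤ.+ step x ≡ (i ℤ.+ step x) ⊔ (j ℤ.+ step x)
  +step-distrib-⊔ = ℤ.mono-≤-distrib-⊔ (ℤ.+-monoˡ-≤ (step x))

reflect : ℕ → Bool → ℕ
reflect k false = suc k
reflect k true  = pred k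

height : List Bool → ℕ
height = foldl reflect 0

height-∷ʳ : ∀ s x → height (s ∷ʳ x) ≡ reflect (height s) x
height-∷ʳ s x = foldl-∷ʳ reflect 0 x s

0⊔[k+step]≡reflect : ∀ k x → 0ℤ ⊔ (+ k ℤ.+ step x) ≡ + reflect k x
0⊔[k+step]≡reflect k       false = cong +_ (ℕ.+-comm k 1)
0⊔[k+step]≡reflect zero    true  = refl
0⊔[k+step]≡reflect (suc k) true  = refl

h≡height : ∀ s → h s ≡ + height s
h≡height s = go (reverseView s)
  where
  go : ∀ {s} → Reverse s → h s ≡ + height s
  go [] = refl
  go (s ∶ r ∶ʳ x) = begin
    h (s ∷ʳ x)                     ≡⟨ h-∷ʳ s x ⟩
    0ℤ ⊔ (h s ℤ.+ step x)          ≡⟨ cong (λ t → 0ℤ ⊔ (t ℤ.+ step x)) (go r) ⟩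
    0ℤ ⊔ (+ height s ℤ.+ step x)   ≡⟨ 0⊔[k+step]≡reflect (height s) x ⟩
    + reflect (height s) x         ≡⟨ cong +_ (sym (height-∷ʳ s x)) ⟩
    + height (s ∷ʳ x)              ∎

count : {A : Set} {P : A → Set} → Decidable P → List A → ℕ
count P? xs = length (filter P? xs)

module _ {A : Set} {P : A → Set} (P? : Decidable P) where

  count-++ : ∀ xs ys → count P? (xs ++ ys) ≡ count P? xs + count P? ys
  count-++ xs ys = trans (cong length (filter-++ P? xs ys)) (length-++ (filter P? xs))

  count-map : {B : Set} (f : B → A) → ∀ xs → count P? (map f xs) ≡ count (λ x → P? (f x)) xs
  count-map f []       = refl
  count-map f (x ∷ xs) with does (P? (f x))
  ... | true  = cong suc (count-map f xs)
  ... | false = count-map f xs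

  count-map-++-map : {B : Set} (f g : B → A) → ∀ xs →
    count P? (map f xs ++ map g xs) ≡ count (λ x → P? (f x)) xs + count (λ x → P? (g x)) xs
  count-map-++-map f g xs =
    trans (count-++ (map f xs) (map g xs)) (cong₂ _+_ (count-map f xs) (count-map g xs))

  count-cong : {Q : A → Set} (Q? : Decidable Q) → (∀ x → does (P? x) ≡ does (Q? x)) →
               ∀ xs → count P? xs ≡ count Q? xs
  count-cong Q? same []       = refl
  count-cong Q? same (x ∷ xs) with does (P? x) | does (Q? x) | same x
  ... | true  | true  | refl = cong suc (count-cong Q? same xs)
  ... | false | false | refl = count-cong Q? same xs

fibre : {A : Set} → (A → ℕ) → List A → ℕ → ℕ
fibre f xs k = count (λ x → f x ≟ k) xs

module _ {A : Set} (f : A → ℕ) where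

  fibre-suc-zero : ∀ xs → fibre (λ x → suc (f x)) xs 0 ≡ 0
  fibre-suc-zero []       = refl
  fibre-suc-zero (x ∷ xs) = fibre-suc-zero xs

  fibre-suc-suc : ∀ xs k → fibre (λ x → suc (f x)) xs (suc k) ≡ fibre f xs k
  fibre-suc-suc []       k = refl
  fibre-suc-suc (x ∷ xs) k with does (f x ≟ k)
  ... | true  = cong suc (fibre-suc-suc xs k)
  ... | false = fibre-suc-suc xs k

  fibre-pred-zero : ∀ xs → fibre (λ x → pred (f x)) xs 0 ≡ fibre f xs 0 + fibre f xs 1
  fibre-pred-zero []       = refl
  fibre-pred-zero (x ∷ xs) with f x
  ... | zero        = cong suc (fibre-pred-zero xs)
  ... | suc zero    = trans (cong suc (fibre-pred-zero xs)) (sym (ℕ.+-suc _ _))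
  ... | suc (suc _) = fibre-pred-zero xs

  fibre-pred-suc : ∀ xs k → fibre (λ x → pred (f x)) xs (suc k) ≡ fibre f xs (suc (suc k))
  fibre-pred-suc []       k = refl
  fibre-pred-suc (x ∷ xs) k with f x
  ... | zero  = fibre-pred-suc xs k
  ... | suc n with does (n ≟ suc k)
  ...   | true  = cong suc (fibre-pred-suc xs k)
  ...   | false = fibre-pred-suc xs k

count-allSeqs-∷ : ∀ {P : List Bool → Set} (P? : Decidable P) m → count P? (allSeqs (suc m)) ≡
  count (λ s → P? (false ∷ s)) (allSeqs m) + count (λ s → P? (true ∷ s)) (allSeqs m)
count-allSeqs-∷ P? m = count-map-++-map P? (false ∷_) (true ∷_) (allSeqs m)

count-allSeqs-∷ʳ : ∀ {P : List Bool → Set} (P? : Decidable P) m → count P? (allSeqs (suc m)) ≡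
  count (λ s → P? (s ∷ʳ false)) (allSeqs m) + count (λ s → P? (s ∷ʳ true)) (allSeqs m)
count-allSeqs-∷ʳ P? zero    = count-map-++-map P? (_∷ʳ false) (_∷ʳ true) (allSeqs zero)
count-allSeqs-∷ʳ P? (suc m) = begin
  count P? (allSeqs (suc (suc m)))
    ≡⟨ count-allSeqs-∷ P? (suc m) ⟩
  count (λ s → P? (false ∷ s)) (allSeqs (suc m)) + count (λ s → P? (true ∷ s)) (allSeqs (suc m))
    ≡⟨ cong₂ _+_ (count-allSeqs-∷ʳ (λ s → P? (false ∷ s)) m) (count-allSeqs-∷ʳ (λ s → P? (true ∷ s)) m) ⟩
  (#[ false , false ] + #[ false , true ]) + (#[ true , false ] + #[ true , true ])
    ≡⟨ interchange #[ false , false ] #[ false , true ] #[ true , false ] #[ true , true ] ⟩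
  (#[ false , false ] + #[ true , false ]) + (#[ false , true ] + #[ true , true ])
    ≡⟨ sym (cong₂ _+_ (count-allSeqs-∷ (λ s → P? (s ∷ʳ false)) m) (count-allSeqs-∷ (λ s → P? (s ∷ʳ true)) m)) ⟩
  count (λ s → P? (s ∷ʳ false)) (allSeqs (suc m)) + count (λ s → P? (s ∷ʳ true)) (allSeqs (suc m)) ∎
  where
  #[_,_] : Bool → Bool → ℕ
  #[ x , y ] = count (λ s → P? (x ∷ (s ∷ʳ y))) (allSeqs m)

fibre-height-suc : ∀ m k → fibre height (allSeqs (suc m)) k ≡
  fibre (λ s → suc (height s)) (allSeqs m) k + fibre (λ s → pred (height s)) (allSeqs m) k
fibre-height-suc m k = trans (count-allSeqs-∷ʳ (λ s → height s ≟ k) m)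
  (cong₂ _+_ (count-cong _ _ (λ s → cong (λ t → does (t ≟ k)) (height-∷ʳ s false)) (allSeqs m))
             (count-cong _ _ (λ s → cong (λ t → does (t ≟ k)) (height-∷ʳ s true)) (allSeqs m)))

⌊n/2⌋≡n/2 : ∀ n → ⌊ n /2⌋ ≡ n / 2
⌊n/2⌋≡n/2 zero          = refl
⌊n/2⌋≡n/2 (suc zero)    = refl
⌊n/2⌋≡n/2 (suc (suc n)) = trans (cong suc (⌊n/2⌋≡n/2 n)) (sym (m/n≡1+[m∸n]/n {suc (suc n)} {2} (s≤s (s≤s z≤n))))

C⌊n/2⌋≡C⌈n/2⌉ : ∀ n → n C ⌊ n /2⌋ ≡ n C ⌈ n /2⌉
C⌊n/2⌋≡C⌈n/2⌉ n = begin
  n C ⌊ n /2⌋           ≡⟨ nCk≡nC[n∸k] (ℕ.⌊n/2⌋≤n n) ⟩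
  n C (n ∸ ⌊ n /2⌋)     ≡⟨ cong (λ t → n C (t ∸ ⌊ n /2⌋)) (sym (ℕ.⌊n/2⌋+⌈n/2⌉≡n n)) ⟩
  n C (⌊ n /2⌋ + ⌈ n /2⌉ ∸ ⌊ n /2⌋) ≡⟨ cong (n C_) (ℕ.m+n∸m≡n ⌊ n /2⌋ ⌈ n /2⌉) ⟩
  n C ⌈ n /2⌉           ∎

binomial-recurrence-zero : ∀ m → suc m C ⌈ suc m + 0 /2⌉ ≡ m C ⌈ m + 0 /2⌉ + m C ⌈ m + 1 /2⌉
binomial-recurrence-zero m rewrite ℕ.+-identityʳ m | ℕ.+-comm m 1 = begin
  suc m C suc ⌊ m /2⌋                  ≡⟨ sym (nCk+nC[k+1]≡[n+1]C[k+1] m ⌊ m /2⌋) ⟩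
  m C ⌊ m /2⌋ + m C suc ⌊ m /2⌋        ≡⟨ cong (_+ m C suc ⌊ m /2⌋) (C⌊n/2⌋≡C⌈n/2⌉ m) ⟩
  m C ⌈ m /2⌉ + m C suc ⌊ m /2⌋        ∎

binomial-recurrence-suc : ∀ m k → suc m C ⌈ suc m + suc k /2⌉ ≡ m C ⌈ m + k /2⌉ + m C ⌈ m + suc (suc k) /2⌉
binomial-recurrence-suc m k rewrite ℕ.+-suc m k | ℕ.+-suc m (suc k) | ℕ.+-suc m k =
  sym (nCk+nC[k+1]≡[n+1]C[k+1] m ⌈ m + k /2⌉)

fibre-height : ∀ m k → fibre height (allSeqs m) k ≡ m C ⌈ m + k /2⌉
fibre-height zero    zero    = refl
fibre-height zero    (suc k) = refl
fibre-height (suc m) zero    = begin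
  fibre height (allSeqs (suc m)) 0    ≡⟨ fibre-height-suc m 0 ⟩
  fibre (λ s → suc (height s)) (allSeqs m) 0 + fibre (λ s → pred (height s)) (allSeqs m) 0
    ≡⟨ cong₂ _+_ (fibre-suc-zero height (allSeqs m)) (fibre-pred-zero height (allSeqs m)) ⟩
  fibre height (allSeqs m) 0 + fibre height (allSeqs m) 1
    ≡⟨ cong₂ _+_ (fibre-height m 0) (fibre-height m 1) ⟩
  m C ⌈ m + 0 /2⌉ + m C ⌈ m + 1 /2⌉  ≡⟨ sym (binomial-recurrence-zero m) ⟩
  suc m C ⌈ suc m + 0 /2⌉             ∎
fibre-height (suc m) (suc k) = begin
  fibre height (allSeqs (suc m)) (suc k) ≡⟨ fibre-height-suc m (suc k) ⟩
  fibre (λ s → suc (height s)) (allSeqs m) (suc k) + fibre (λ s → pred (height s)) (allSeqs m) (suc k)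
    ≡⟨ cong₂ _+_ (fibre-suc-suc height (allSeqs m) k) (fibre-pred-suc height (allSeqs m) k) ⟩
  fibre height (allSeqs m) k + fibre height (allSeqs m) (suc (suc k))
    ≡⟨ cong₂ _+_ (fibre-height m k) (fibre-height m (suc (suc k))) ⟩
  m C ⌈ m + k /2⌉ + m C ⌈ m + suc (suc k) /2⌉ ≡⟨ sym (binomial-recurrence-suc m k) ⟩
  suc m C ⌈ suc m + suc k /2⌉                ∎

mainTheorem2 : (n : ℕ) → 1 ≤ n → (k : ℕ) →
    countH (n ∸ 1) (+ k) ≡ (n ∸ 1) C ((n + k) / 2)
mainTheorem2 (suc m) _ k = begin
  countH m (+ k)                ≡⟨ count-cong _ _ (λ s → cong (λ t → does (t ℤ.≟ + k)) (h≡height s)) (allSeqs m) ⟩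
  fibre height (allSeqs m) k    ≡⟨ fibre-height m k ⟩
  m C ⌈ m + k /2⌉               ≡⟨ cong (m C_) (⌊n/2⌋≡n/2 (suc m + k)) ⟩
  m C ((suc m + k) / 2)         ∎
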